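{- Let $\pi$ be a permutation of type $(k,n)$ and let $\mathcal I=(I_1,\dots,I_n)$ be a Grassmannlike necklace, with removal permutation $\rho$, that can be obtained from the forward Grassmann necklace $\vec{\mathcal I}_\pi$ by a finite sequence of noncrossing toggles. Let $y,z\in[n]$. If $y<_z\pi(z)$ and $y\notin I_{\rho^{ -1}(z)}$, then $(I_{\rho^{ -1}(z)}\setminus\{z\})\cup\{y\}\notin\mathcal M_\pi$. Likewise, if $\pi(z)<_zy$ and $y\in I_{\rho^{ -1}(z)}$, then $(I_{\rho^{ -1}(z)}\setminus\{y\})\cup\{\pi(z)\}\notin\mathcal M_\pi$.
   Context: Indices mod $n$. $<_z$ is the total order $z<_zz+1<_z\dots<_zn<_z1<_z\dots<_zz-1$ on $[n]$. $\pi\in S_n$ has type $(k,n)$ if $\#\{a:a\le\pi^{ -1}(a)\}=k$. Forward Grassmann necklace: $\vec I_1=\{a:a\le\pi^{ -1}(a)\}$, $\vec I_{a+1}=(\vec I_a\setminus\{a\})\cup\{\pi(a)\}$. $\mathcal M_\pi=\{S\in\binom{[n]}k:\vec I_i\le_iS\ \forall i\}$, where $\le_i$ compares $k$-sets elementwise after sorting by $<_i$. Grassmannlike necklace: $(I_1,\dots,I_n)$ of $k$-subsets with removal permutation $\rho$ and insertion permutation $\iota$, $\rho(a)\in I_a$, $I_{a+1}=(I_a\setminus\{\rho(a)\})\cup\{\iota(a)\}$; trip permutation $\iota\rho^{ -1}$ ($\vec{\mathcal I}_\pi$ has removal identity, insertion $\pi$). Toggling at $a$ (allowed if $\rho(a-1)\ne\iota(a)$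 and $\rho(a)\ne\iota(a-1)$) replaces $(\rho,\iota)$ by $(\rho s_{a-1},\iota s_{a-1})$, $s_{a-1}$ the transposition of $a-1,a$; only $I_a$ changes. The toggle is noncrossing if the chords $\rho(a-1)\mapsto\iota(a-1)$ and $\rho(a)\mapsto\iota(a)$, drawn in a disk with boundary points $1,\dots,n$, do not intersect (including at the boundary). -}

module Defs where

open import Data.Nat using (ℕ; zero; suc; _+_; _∸_; _≤_; _<_; _≤?_)
open import Data.Nat.DivMod using (_%_; m%n<n)
open import Data.Fin using (Fin; toℕ; fromℕ<; _≟_)
open import Data.Bool using (if_then_else_)
open import Data.Fin.Subset using (Subset; _∈_; _∉_; _∪_; _-_; ⁅_⁆; ∣_∣)
open import Data.Fin.Subset.Properties using (_∈?_)
open import Data.Fin.Permutation using (Permutation′; _⟨$⟩ʳ_; _⟨$⟩ˡ_; _∘ₚ_; transpose; id)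
open import Data.List using (List; map; upTo; filter)
open import Data.List.Relation.Binary.Pointwise using (Pointwise)
open import Data.Vec using (tabulate)
open import Data.Product using (_×_)
open import Data.Sum using (_⊎_)
open import Relation.Nullary using (¬_; does)
open import Relation.Binary.PropositionalEquality using (_≡_; _≢_)

-- Convention: [n] = {1,…,n} is represented by Fin n = {0,…,n-1}
-- (element a of Fin n stands for a+1).  All indices are taken mod n.

cyc : ∀ {n} → Fin n → ℕ → Fin n
cyc {suc m} i d = fromℕ< (m%n<n (toℕ i + d) (suc m))

next prev : ∀ {n} → Fin n → Fin n
next a = cyc a 1
prev {n} a = cyc a (n ∸ 1)

-- the element j (mod n) of Fin n (first argument only witnesses n ≠ 0)
elt : ∀ {n} → Fin n → ℕ → Fin n
elt {suc m} _ j = fromℕ< (m%n<n j (suc m))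

-- position of a in the order <_z : z <_z z+1 <_z … <_z z-1
rank : ∀ {n} → Fin n → Fin n → ℕ
rank {suc m} z a = (toℕ a + (suc m ∸ toℕ z)) % suc m

_≤[_]_ : ∀ {n} → Fin n → Fin n → Fin n → Set
a ≤[ z ] b = rank z a ≤ rank z b

_<[_]_ : ∀ {n} → Fin n → Fin n → Fin n → Set
a <[ z ] b = rank z a < rank z b

sortedFrom : ∀ {n} → Fin n → Subset n → List (Fin n)
sortedFrom {n} i S = filter (λ a → a ∈? S) (map (cyc i) (upTo n))

_≤ᴳ[_]_ : ∀ {n} → Subset n → Fin n → Subset n → Set
A ≤ᴳ[ i ] B = Pointwise (λ a b → a ≤[ i ] b) (sortedFrom i A) (sortedFrom i B)

antiExc : ∀ {n} → Permutation′ n → Subset n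
antiExc π = tabulate (λ a → does (toℕ a ≤? toℕ (π ⟨$⟩ˡ a)))

HasType : ∀ {n} → Permutation′ n → ℕ → Set
HasType π k = ∣ antiExc π ∣ ≡ k

-- forward Grassmann necklace: fwd π j = I_{j+1}, via
-- I_1 = antiExc π, I_{a+1} = (I_a ∖ {a}) ∪ {π(a)}
fwdℕ : ∀ {n} → Permutation′ n → Fin n → ℕ → Subset n
fwdℕ π o zero = antiExc π
fwdℕ π o (suc j) = (fwdℕ π o j - elt o j) ∪ ⁅ π ⟨$⟩ʳ elt o j ⁆

fwdNecklace : ∀ {n} → Permutation′ n → Fin n → Subset n
fwdNecklace π a = fwdℕ π a (toℕ a)

Mπ : ∀ {n} → Permutation′ n → ℕ → Subset n → Set
Mπ π k S = (∣ S ∣ ≡ k) × (∀ i → fwdNecklace π i ≤ᴳ[ i ] S)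

-- Grassmannlike necklace data: subsets I, removal ρ, insertion ι
record Necklace (n : ℕ) : Set where
  constructor necklace
  field
    I : Fin n → Subset n
    ρ : Permutation′ n
    ι : Permutation′ n
open Necklace public

fwd : ∀ {n} → Permutation′ n → Necklace n
fwd π = necklace (fwdNecklace π) id π

Btw : ∀ {n} → Fin n → Fin n → Fin n → Set
Btw p q x = (0 < rank p x) × (rank p x < rank p q)

-- chords p→q and r→s do not intersect (not even at the boundary)
NonCrossing : ∀ {n} → Fin n → Fin n → Fin n → Fin n → Set
NonCrossing p q r s =
  (p ≢ r) × (p ≢ s) × (q ≢ r) × (q ≢ s) ×
  ¬ ((Btw p q r × ¬ Btw p q s) ⊎ (¬ Btw p q r × Btw p q s))

update : ∀ {n} → (Fin n → Subset n) → Fin n → Subset n → Fin n → Subset n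
update I a X j = if does (j ≟ a) then X else I j

-- toggling at a: (ρ,ι) ↦ (ρ s_{a-1}, ι s_{a-1}); only I_a changes,
-- to I'_a = (I_{a-1} ∖ {ρ'(a-1)}) ∪ {ι'(a-1)} = (I_{a-1} ∖ {ρ(a)}) ∪ {ι(a)}
toggle : ∀ {n} → Necklace n → Fin n → Necklace n
toggle N a = necklace
  (update (I N) a ((I N (prev a) - (ρ N ⟨$⟩ʳ a)) ∪ ⁅ ι N ⟨$⟩ʳ a ⁆))
  (transpose (prev a) a ∘ₚ ρ N)
  (transpose (prev a) a ∘ₚ ι N)

NoncrossingToggle : ∀ {n} → Necklace n → Fin n → Set
NoncrossingToggle N a =
  (ρ N ⟨$⟩ʳ prev a ≢ ι N ⟨$⟩ʳ a) × (ρ N ⟨$⟩ʳ a ≢ ι N ⟨$⟩ʳ prev a) ×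
  NonCrossing (ρ N ⟨$⟩ʳ prev a) (ι N ⟨$⟩ʳ prev a) (ρ N ⟨$⟩ʳ a) (ι N ⟨$⟩ʳ a)

data Reachable {n} (π : Permutation′ n) : Necklace n → Set where
  base : Reachable π (fwd π)
  step : ∀ {N} a → Reachable π N → NoncrossingToggle N a → Reachable π (toggle N a)

-- Consider a step I_b → I_{b+1} of the necklace that removes r = ρ(b) and inserts π(r), and count
-- the elements of I_b on the open arc from r to π(r).  For the forward necklace this is the count
-- of its own member at r.  A noncrossing toggle swaps two consecutive steps whose chords do not
-- cross, so the two elements exchanged by one step lie on the same side of the other step's chord
-- and the count is unchanged.  At b = ρ⁻¹(z), the first set of the statement therefore has one
-- element more on the arc from z to π(z) than the forward member at z + 1, and the second one
-- more element among z, …, π(z) than the forward member at z (or, if π(z) = z, one element fewer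
-- in total than the forward member at z + 1), contradicting the Gale conditions defining M_π.

module Submission where

open import Defs
open import Data.Bool using (Bool; true; false; _∧_; _∨_; not)
open import Data.Bool.Properties using (∨-identityʳ; ∨-zeroʳ; ∧-identityʳ; ∧-zeroʳ; ∧-assoc; ∧-comm)
open import Data.Empty using (⊥-elim)
open import Data.Fin using (Fin; toℕ; _≟_)
import Data.Fin as Fin
open import Data.Fin.Properties using (toℕ-fromℕ<; toℕ-injective; toℕ<n)
open import Data.Fin.Permutation using (Permutation′; _⟨$⟩ʳ_; _⟨$⟩ˡ_; inverseˡ; inverseʳ)
import Data.Fin.Permutation.Components as PC
open import Data.Fin.Subset using (Subset; _∈_; _∉_; _∪_; _-_; _─_; ⁅_⁆)
open import Data.Fin.Subset.Properties using (_∈?_)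
open import Data.List using (_∷_; length; filter; applyUpTo)
open import Data.List.Properties using (map-applyUpTo; filter-all)
open import Data.List.Relation.Binary.Pointwise using (Pointwise; []; _∷_; Pointwise-length)
open import Data.List.Relation.Unary.All using (universal)
open import Data.Nat using (ℕ; zero; suc; _+_; _∸_; _≤_; _<_; z≤n; s≤s; s≤s⁻¹; z<s; s<s; _≤?_; _<?_; NonZero)
open import Data.Nat.DivMod using (_%_; %-distribˡ-+; m%n%n≡m%n; [m+n]%n≡m%n; m<n⇒m%n≡m; m%n<n)
open import Data.Nat.Properties hiding (_≟_)
open import Data.Product using (_×_; _,_; proj₁; proj₂)
open import Data.Sum using (_⊎_; inj₁; inj₂)
open import Data.Vec using (lookup; _∷_)
open import Data.Vec.Properties
  using (lookup-zipWith; lookup-replicate; lookup∘tabulate; tabulate∘lookup; tabulate-cong; []=⇒lookup; lookup⇒[]=)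
open import Function using (_∘_; _⇔_; mk⇔; Equivalence)
open import Function.Construct.Composition using (_⇔-∘_)
open import Function.Construct.Symmetry using (⇔-sym)
open import Level using (0ℓ)
open import Relation.Binary using (tri<; tri≈; tri>)
open import Relation.Binary.PropositionalEquality
open import Relation.Nullary using (¬_; Dec; yes; no; does; contradiction)
open import Relation.Nullary.Decidable using (dec-true; dec-false; does-⇔; _×-dec_)
open import Relation.Unary using (Pred; Decidable)

¬xor⇒⇔ : ∀ {A B : Set} → Dec A → Dec B → ¬ ((A × ¬ B) ⊎ (¬ A × B)) → A ⇔ B
¬xor⇒⇔ (yes a) (yes b) _    = mk⇔ (λ _ → b) (λ _ → a)
¬xor⇒⇔ (yes a) (no ¬b) ¬xor = ⊥-elim (¬xor (inj₁ (a , ¬b)))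
¬xor⇒⇔ (no ¬a) (yes b) ¬xor = ⊥-elim (¬xor (inj₂ (¬a , b)))
¬xor⇒⇔ (no ¬a) (no ¬b) _    = mk⇔ (⊥-elim ∘ ¬a) (⊥-elim ∘ ¬b)

-- Subsets as Boolean vectors

lookup-⁅⁆ : ∀ {n} (y x : Fin n) → lookup ⁅ y ⁆ x ≡ does (x ≟ y)
lookup-⁅⁆ Fin.zero    Fin.zero    = refl
lookup-⁅⁆ Fin.zero    (Fin.suc x) = lookup-replicate x false
lookup-⁅⁆ (Fin.suc y) Fin.zero    = refl
lookup-⁅⁆ (Fin.suc y) (Fin.suc x) = lookup-⁅⁆ y x

lookup-─ : ∀ {n} (S T : Subset n) (x : Fin n) → lookup (S ─ T) x ≡ not (lookup T x) ∧ lookup S x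
lookup-─ (_ ∷ S) (true ∷ T)  Fin.zero    = refl
lookup-─ (_ ∷ S) (false ∷ T) Fin.zero    = refl
lookup-─ (_ ∷ S) (_ ∷ T)     (Fin.suc x) = lookup-─ S T x

lookup-remove : ∀ {n} (S : Subset n) (y x : Fin n) → lookup (S - y) x ≡ not (does (x ≟ y)) ∧ lookup S x
lookup-remove S y x = trans (lookup-─ S ⁅ y ⁆ x) (cong (λ b → not b ∧ lookup S x) (lookup-⁅⁆ y x))

remove-removed : ∀ {n} (S : Subset n) (y : Fin n) → lookup (S - y) y ≡ false
remove-removed S y rewrite lookup-remove S y y | dec-true (y ≟ y) refl = refl

remove-other : ∀ {n} (S : Subset n) {y x : Fin n} → x ≢ y → lookup (S - y) x ≡ lookup S x
remove-other S {y} {x} x≢y rewrite lookup-remove S y x | dec-false (x ≟ y) x≢y = refl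

lookup-exchange : ∀ {n} (S : Subset n) (y w x : Fin n) →
  lookup ((S - y) ∪ ⁅ w ⁆) x ≡ (not (does (x ≟ y)) ∧ lookup S x) ∨ does (x ≟ w)
lookup-exchange S y w x =
  trans (lookup-zipWith _∨_ x (S - y) ⁅ w ⁆) (cong₂ _∨_ (lookup-remove S y x) (lookup-⁅⁆ w x))

exchange-inserted : ∀ {n} (S : Subset n) (y w : Fin n) → lookup ((S - y) ∪ ⁅ w ⁆) w ≡ true
exchange-inserted S y w
  rewrite lookup-exchange S y w w | dec-true (w ≟ w) refl = ∨-zeroʳ _

exchange-removed : ∀ {n} (S : Subset n) {y w : Fin n} → y ≢ w → lookup ((S - y) ∪ ⁅ w ⁆) y ≡ false
exchange-removed S {y} {w} y≢w
  rewrite lookup-exchange S y w y | dec-true (y ≟ y) refl | dec-false (y ≟ w) y≢w = refl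

exchange-≢inserted : ∀ {n} (S : Subset n) {y w x : Fin n} → x ≢ w →
  lookup ((S - y) ∪ ⁅ w ⁆) x ≡ lookup (S - y) x
exchange-≢inserted S {y} {w} {x} x≢w
  rewrite lookup-zipWith _∨_ x (S - y) ⁅ w ⁆ | lookup-⁅⁆ w x | dec-false (x ≟ w) x≢w = ∨-identityʳ _

exchange-other : ∀ {n} (S : Subset n) {y w x : Fin n} → x ≢ y → x ≢ w →
  lookup ((S - y) ∪ ⁅ w ⁆) x ≡ lookup S x
exchange-other S x≢y x≢w = trans (exchange-≢inserted S x≢w) (remove-other S x≢y)

subset-ext : ∀ {n} {S T : Subset n} → (∀ x → lookup S x ≡ lookup T x) → S ≡ T
subset-ext {S = S} {T} S≗T =
  trans (sym (tabulate∘lookup S)) (trans (tabulate-cong S≗T) (tabulate∘lookup T))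

exchange-self : ∀ {n} (S : Subset n) {u : Fin n} → lookup S u ≡ true → (S - u) ∪ ⁅ u ⁆ ≡ S
exchange-self S {u} u∈S = subset-ext same
  where
  same : ∀ x → lookup ((S - u) ∪ ⁅ u ⁆) x ≡ lookup S x
  same x with x ≟ u
  ... | yes refl = trans (exchange-inserted S x x) (sym u∈S)
  ... | no x≢u = exchange-other S x≢u x≢u

does≡true⇒≡ : ∀ {n} {x y : Fin n} → does (x ≟ y) ≡ true → x ≡ y
does≡true⇒≡ {x = x} {y} eq with x ≟ y | eq
... | yes x≡y | _ = x≡y
... | no _ | ()

exchange-comm : ∀ {n} (S : Subset n) {p q r s : Fin n} → q ≢ r → p ≢ s →
  (((S - p) ∪ ⁅ q ⁆) - r) ∪ ⁅ s ⁆ ≡ (((S - r) ∪ ⁅ s ⁆) - p) ∪ ⁅ q ⁆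
exchange-comm S {p} {q} {r} {s} q≢r p≢s = subset-ext λ x →
  begin
    lookup ((((S - p) ∪ ⁅ q ⁆) - r) ∪ ⁅ s ⁆) x
      ≡⟨ lookup-exchange ((S - p) ∪ ⁅ q ⁆) r s x ⟩
    (not (does (x ≟ r)) ∧ lookup ((S - p) ∪ ⁅ q ⁆) x) ∨ does (x ≟ s)
      ≡⟨ cong (λ b → (not (does (x ≟ r)) ∧ b) ∨ does (x ≟ s)) (lookup-exchange S p q x) ⟩
    (not (does (x ≟ r)) ∧ ((not (does (x ≟ p)) ∧ lookup S x) ∨ does (x ≟ q))) ∨ does (x ≟ s)
      ≡⟨ commᵇ (does (x ≟ p)) (does (x ≟ q)) (does (x ≟ r)) (does (x ≟ s)) (lookup S x)
           (λ x≡q → dec-false (x ≟ r) (λ x≡r → q≢r (trans (sym (does≡true⇒≡ x≡q)) x≡r)))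
           (λ x≡s → dec-false (x ≟ p) (λ x≡p → p≢s (trans (sym x≡p) (does≡true⇒≡ x≡s)))) ⟩
    (not (does (x ≟ p)) ∧ ((not (does (x ≟ r)) ∧ lookup S x) ∨ does (x ≟ s))) ∨ does (x ≟ q)
      ≡⟨ sym (cong (λ b → (not (does (x ≟ p)) ∧ b) ∨ does (x ≟ q)) (lookup-exchange S r s x)) ⟩
    (not (does (x ≟ p)) ∧ lookup ((S - r) ∪ ⁅ s ⁆) x) ∨ does (x ≟ q)
      ≡⟨ sym (lookup-exchange ((S - r) ∪ ⁅ s ⁆) p q x) ⟩
    lookup ((((S - r) ∪ ⁅ s ⁆) - p) ∪ ⁅ q ⁆) x ∎
  where
  open ≡-Reasoning
  commᵇ : ∀ a b c d i → (b ≡ true → c ≡ false) → (d ≡ true → a ≡ false) →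
    (not c ∧ ((not a ∧ i) ∨ b)) ∨ d ≡ (not a ∧ ((not c ∧ i) ∨ d)) ∨ b
  commᵇ a true c d i b⇒¬c _
    rewrite b⇒¬c refl | ∨-zeroʳ (not a ∧ i) | ∨-zeroʳ (not a ∧ (i ∨ d)) = refl
  commᵇ a false c true i _ d⇒¬a
    rewrite d⇒¬a refl | ∨-zeroʳ (not c ∧ i) | ∨-zeroʳ (not c ∧ (i ∨ false)) = refl
  commᵇ a false c false i _ _
    rewrite ∨-identityʳ (not a ∧ i) | ∨-identityʳ (not c ∧ i)
          | ∨-identityʳ (not c ∧ (not a ∧ i)) | ∨-identityʳ (not a ∧ (not c ∧ i))
          | sym (∧-assoc (not c) (not a) i) | ∧-comm (not c) (not a) = ∧-assoc (not a) (not c) i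

does-∈? : ∀ {n} (x : Fin n) (S : Subset n) → does (x ∈? S) ≡ lookup S x
does-∈? Fin.zero    (true ∷ S)  = refl
does-∈? Fin.zero    (false ∷ S) = refl
does-∈? (Fin.suc x) (_ ∷ S)     = does-∈? x S

∉⇒lookup≡false : ∀ {n} {x : Fin n} {S : Subset n} → x ∉ S → lookup S x ≡ false
∉⇒lookup≡false {x = x} {S} x∉S with lookup S x in eq
... | true = ⊥-elim (x∉S (lookup⇒[]= x S eq))
... | false = refl

transpose-matchˡ : ∀ {n} (i j : Fin n) → PC.transpose i j i ≡ j
transpose-matchˡ i j rewrite dec-true (i ≟ i) refl = refl

transpose-matchʳ : ∀ {n} (i j : Fin n) → j ≢ i → PC.transpose i j j ≡ i
transpose-matchʳ i j j≢i rewrite dec-false (j ≟ i) j≢i | dec-true (j ≟ j) refl = refl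

transpose-other : ∀ {n} (i j : Fin n) {x : Fin n} → x ≢ i → x ≢ j → PC.transpose i j x ≡ x
transpose-other i j {x} x≢i x≢j rewrite dec-false (x ≟ i) x≢i | dec-false (x ≟ j) x≢j = refl

update-≡ : ∀ {n} (J : Fin n → Subset n) (a : Fin n) (X : Subset n) → update J a X a ≡ X
update-≡ J a X rewrite dec-true (a ≟ a) refl = refl

update-≢ : ∀ {n} (J : Fin n → Subset n) {a : Fin n} (X : Subset n) {j : Fin n} → j ≢ a → update J a X j ≡ J j
update-≢ J {a} X {j} j≢a rewrite dec-false (j ≟ a) j≢a = refl

bit : Bool → ℕ
bit true  = 1
bit false = 0

tally : (ℕ → Bool) → ℕ → ℕ
tally f zero    = 0
tally f (suc t) = bit (f 0) + tally (f ∘ suc) t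

tally-cong : ∀ t {f g : ℕ → Bool} → (∀ d → d < t → f d ≡ g d) → tally f t ≡ tally g t
tally-cong zero    f≗g = refl
tally-cong (suc t) f≗g =
  cong₂ _+_ (cong bit (f≗g 0 z<s)) (tally-cong t (λ d d<t → f≗g (suc d) (s<s d<t)))

tally-one-more : ∀ t {f g : ℕ → Bool} d₀ → d₀ < t → f d₀ ≡ true → g d₀ ≡ false →
  (∀ d → d < t → d ≢ d₀ → f d ≡ g d) → tally f t ≡ suc (tally g t)
tally-one-more (suc t) zero _ f₀ g₀ f≗g rewrite f₀ | g₀ =
  cong suc (tally-cong t (λ d d<t → f≗g (suc d) (s<s d<t) λ ()))
tally-one-more (suc t) {f} {g} (suc d₀) (s≤s d₀<t) f₀ g₀ f≗g rewrite f≗g 0 z<s (λ ()) =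
  trans (cong (bit (g 0) +_) (tally-one-more t d₀ d₀<t f₀ g₀
          (λ d d<t d≢d₀ → f≗g (suc d) (s<s d<t) (d≢d₀ ∘ suc-injective))))
        (+-suc (bit (g 0)) _)

tally-beyond : ∀ t k (f : ℕ → Bool) → t ≤ k → (∀ d → t ≤ d → d < k → f d ≡ false) →
  tally f k ≡ tally f t
tally-beyond zero    zero    f _ _ = refl
tally-beyond zero    (suc k) f _ f≡false rewrite f≡false 0 z≤n z<s =
  tally-beyond zero k (f ∘ suc) z≤n (λ d _ d<k → f≡false (suc d) z≤n (s<s d<k))
tally-beyond (suc t) (suc k) f (s≤s t≤k) f≡false =
  cong (bit (f 0) +_) (tally-beyond t k (f ∘ suc) t≤k (λ d t≤d d<k → f≡false (suc d) (s≤s t≤d) (s<s d<k)))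

tally-snoc : ∀ t (f : ℕ → Bool) → tally f (suc t) ≡ tally f t + bit (f t)
tally-snoc zero    f = +-identityʳ _
tally-snoc (suc t) f =
  trans (cong (bit (f 0) +_) (tally-snoc t (f ∘ suc))) (sym (+-assoc (bit (f 0)) _ _))

module _ {A : Set} where

  length-filter-mono : {R : A → A → Set} {Q : Pred A 0ℓ} (Q? : Decidable Q) →
    (∀ {a b} → R a b → Q b → Q a) → ∀ {xs ys} → Pointwise R xs ys →
    length (filter Q? ys) ≤ length (filter Q? xs)
  length-filter-mono Q? Q-down [] = z≤n
  length-filter-mono Q? Q-down {x ∷ xs} {y ∷ ys} (Rxy ∷ Rxsys) with Q? y | Q? x
  ... | yes _  | yes _  = s≤s (length-filter-mono Q? Q-down Rxsys)
  ... | yes Qy | no ¬Qx = ⊥-elim (¬Qx (Q-down Rxy Qy))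
  ... | no _   | yes _  = m≤n⇒m≤1+n (length-filter-mono Q? Q-down Rxsys)
  ... | no _   | no _   = length-filter-mono Q? Q-down Rxsys

  length-filter-filter-applyUpTo : {P Q : Pred A 0ℓ} (P? : Decidable P) (Q? : Decidable Q) (g : ℕ → A) (k : ℕ) →
    length (filter Q? (filter P? (applyUpTo g k))) ≡ tally (λ d → does (P? (g d)) ∧ does (Q? (g d))) k
  length-filter-filter-applyUpTo P? Q? g zero = refl
  length-filter-filter-applyUpTo P? Q? g (suc k) with P? (g 0)
  ... | no _ = length-filter-filter-applyUpTo P? Q? (g ∘ suc) k
  ... | yes _ with Q? (g 0)
  ...   | yes _ = cong suc (length-filter-filter-applyUpTo P? Q? (g ∘ suc) k)
  ...   | no _  = length-filter-filter-applyUpTo P? Q? (g ∘ suc) k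

[m%d+n]%d≡[m+n]%d : ∀ m n d .{{_ : NonZero d}} → (m % d + n) % d ≡ (m + n) % d
[m%d+n]%d≡[m+n]%d m n d = begin
  (m % d + n) % d           ≡⟨ %-distribˡ-+ (m % d) n d ⟩
  (m % d % d + n % d) % d   ≡⟨ cong (λ u → (u + n % d) % d) (m%n%n≡m%n m d) ⟩
  (m % d + n % d) % d       ≡⟨ sym (%-distribˡ-+ m n d) ⟩
  (m + n) % d               ∎
  where open ≡-Reasoning

[m+n%d]%d≡[m+n]%d : ∀ m n d .{{_ : NonZero d}} → (m + n % d) % d ≡ (m + n) % d
[m+n%d]%d≡[m+n]%d m n d = begin
  (m + n % d) % d   ≡⟨ cong (_% d) (+-comm m (n % d)) ⟩
  (n % d + m) % d   ≡⟨ [m%d+n]%d≡[m+n]%d n m d ⟩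
  (n + m) % d       ≡⟨ cong (_% d) (+-comm n m) ⟩
  (m + n) % d       ∎
  where open ≡-Reasoning

[m+n]%d-cases : ∀ {d} .{{_ : NonZero d}} m n → m < d → n < d →
  ((m + n) % d ≡ m + n × m + n < d) ⊎ ((m + n) % d + d ≡ m + n × d ≤ m + n)
[m+n]%d-cases {d} m n m<d n<d with m + n <? d
... | yes m+n<d = inj₁ (m<n⇒m%n≡m m+n<d , m+n<d)
... | no m+n≮d = inj₂ (wrapped , d≤m+n)
  where
  d≤m+n = ≮⇒≥ m+n≮d
  k = m + n ∸ d
  k+d≡m+n : k + d ≡ m + n
  k+d≡m+n = m∸n+n≡m d≤m+n
  k<d : k < d
  k<d = +-cancelʳ-< d k d (subst (_< d + d) (sym k+d≡m+n) (+-mono-< m<d n<d))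
  wrapped : (m + n) % d + d ≡ m + n
  wrapped = begin
    (m + n) % d + d   ≡⟨ cong (λ u → u % d + d) (sym k+d≡m+n) ⟩
    (k + d) % d + d   ≡⟨ cong (_+ d) ([m+n]%n≡m%n k d) ⟩
    k % d + d         ≡⟨ cong (_+ d) (m<n⇒m%n≡m k<d) ⟩
    k + d             ≡⟨ k+d≡m+n ⟩
    m + n             ∎
    where open ≡-Reasoning

-- The cyclic order on Fin n

module _ {m : ℕ} where

  private
    n : ℕ
    n = suc m

  toℕ-cyc : (i : Fin n) (d : ℕ) → toℕ (cyc i d) ≡ (toℕ i + d) % n
  toℕ-cyc i d = toℕ-fromℕ< _

  rank< : (z a : Fin n) → rank z a < n
  rank< z a = m%n<n (toℕ a + (n ∸ toℕ z)) n

  rank-cyc : (i : Fin n) (d : ℕ) → rank i (cyc i d) ≡ d % n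
  rank-cyc i d = begin
    (toℕ (cyc i d) + (n ∸ toℕ i)) % n     ≡⟨ cong (λ u → (u + (n ∸ toℕ i)) % n) (toℕ-cyc i d) ⟩
    ((toℕ i + d) % n + (n ∸ toℕ i)) % n   ≡⟨ [m%d+n]%d≡[m+n]%d (toℕ i + d) (n ∸ toℕ i) n ⟩
    (toℕ i + d + (n ∸ toℕ i)) % n         ≡⟨ cong (_% n) shift ⟩
    (d + n) % n                           ≡⟨ [m+n]%n≡m%n d n ⟩
    d % n                                 ∎
    where
    open ≡-Reasoning
    shift : toℕ i + d + (n ∸ toℕ i) ≡ d + n
    shift = begin
      toℕ i + d + (n ∸ toℕ i)     ≡⟨ cong (_+ (n ∸ toℕ i)) (+-comm (toℕ i) d) ⟩
      d + toℕ i + (n ∸ toℕ i)     ≡⟨ +-assoc d (toℕ i) _ ⟩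
      d + (toℕ i + (n ∸ toℕ i))   ≡⟨ cong (d +_) (m+[n∸m]≡n (<⇒≤ (toℕ<n i))) ⟩
      d + n                       ∎

  rank-cyc-< : (i : Fin n) {d : ℕ} → d < n → rank i (cyc i d) ≡ d
  rank-cyc-< i {d} d<n = trans (rank-cyc i d) (m<n⇒m%n≡m d<n)

  cyc-rank : (i a : Fin n) → cyc i (rank i a) ≡ a
  cyc-rank i a = toℕ-injective (begin
    toℕ (cyc i (rank i a))                     ≡⟨ toℕ-cyc i _ ⟩
    (toℕ i + (toℕ a + (n ∸ toℕ i)) % n) % n    ≡⟨ [m+n%d]%d≡[m+n]%d (toℕ i) _ n ⟩
    (toℕ i + (toℕ a + (n ∸ toℕ i))) % n        ≡⟨ cong (_% n) shift ⟩
    (toℕ a + n) % n                            ≡⟨ [m+n]%n≡m%n (toℕ a) n ⟩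
    toℕ a % n                                  ≡⟨ m<n⇒m%n≡m (toℕ<n a) ⟩
    toℕ a                                      ∎)
    where
    open ≡-Reasoning
    shift : toℕ i + (toℕ a + (n ∸ toℕ i)) ≡ toℕ a + n
    shift = begin
      toℕ i + (toℕ a + (n ∸ toℕ i))   ≡⟨ sym (+-assoc (toℕ i) _ _) ⟩
      toℕ i + toℕ a + (n ∸ toℕ i)     ≡⟨ cong (_+ (n ∸ toℕ i)) (+-comm (toℕ i) (toℕ a)) ⟩
      toℕ a + toℕ i + (n ∸ toℕ i)     ≡⟨ +-assoc (toℕ a) (toℕ i) _ ⟩
      toℕ a + (toℕ i + (n ∸ toℕ i))   ≡⟨ cong (toℕ a +_) (m+[n∸m]≡n (<⇒≤ (toℕ<n i))) ⟩
      toℕ a + n                       ∎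

  rank-injective : (i : Fin n) {a b : Fin n} → rank i a ≡ rank i b → a ≡ b
  rank-injective i {a} {b} eq = trans (sym (cyc-rank i a)) (trans (cong (cyc i) eq) (cyc-rank i b))

  cyc-+ : (i : Fin n) (d e : ℕ) → cyc (cyc i d) e ≡ cyc i (d + e)
  cyc-+ i d e = toℕ-injective (begin
    toℕ (cyc (cyc i d) e)       ≡⟨ toℕ-cyc (cyc i d) e ⟩
    (toℕ (cyc i d) + e) % n     ≡⟨ cong (λ u → (u + e) % n) (toℕ-cyc i d) ⟩
    ((toℕ i + d) % n + e) % n   ≡⟨ [m%d+n]%d≡[m+n]%d (toℕ i + d) e n ⟩
    (toℕ i + d + e) % n         ≡⟨ cong (_% n) (+-assoc (toℕ i) d e) ⟩
    (toℕ i + (d + e)) % n       ≡⟨ sym (toℕ-cyc i (d + e)) ⟩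
    toℕ (cyc i (d + e))         ∎)
    where open ≡-Reasoning

  cyc-0 : (i : Fin n) → cyc i 0 ≡ i
  cyc-0 i = toℕ-injective
    (trans (toℕ-cyc i 0) (trans (cong (_% n) (+-identityʳ (toℕ i))) (m<n⇒m%n≡m (toℕ<n i))))

  cyc-n : (i : Fin n) → cyc i n ≡ i
  cyc-n i = toℕ-injective (trans (toℕ-cyc i n) (trans ([m+n]%n≡m%n (toℕ i) n) (m<n⇒m%n≡m (toℕ<n i))))

  cyc-suc : (i : Fin n) (d : ℕ) → cyc i (suc d) ≡ cyc (next i) d
  cyc-suc i d = sym (cyc-+ i 1 d)

  rank-self : (i : Fin n) → rank i i ≡ 0
  rank-self i = trans (cong (rank i) (sym (cyc-0 i))) (rank-cyc-< i z<s)

  <[]⇒≢base : (z a b : Fin n) → a <[ z ] b → b ≢ z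
  <[]⇒≢base z a b a<b b≡z = n≮0 (subst (rank z a <_) (trans (cong (rank z) b≡z) (rank-self z)) a<b)

  rank≡0⇒≡ : (i a : Fin n) → rank i a ≡ 0 → a ≡ i
  rank≡0⇒≡ i a eq = rank-injective i (trans eq (sym (rank-self i)))

  rank-+ : (p r x : Fin n) → rank p x ≡ (rank p r + rank r x) % n
  rank-+ p r x = begin
    rank p x                                 ≡⟨ cong (rank p) (sym via-r) ⟩
    rank p (cyc p (rank p r + rank r x))     ≡⟨ rank-cyc p _ ⟩
    (rank p r + rank r x) % n                ∎
    where
    open ≡-Reasoning
    via-r : cyc p (rank p r + rank r x) ≡ x
    via-r = begin
      cyc p (rank p r + rank r x)         ≡⟨ sym (cyc-+ p (rank p r) (rank r x)) ⟩
      cyc (cyc p (rank p r)) (rank r x)   ≡⟨ cong (λ u → cyc u (rank r x)) (cyc-rank p r) ⟩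
      cyc r (rank r x)                    ≡⟨ cyc-rank r x ⟩
      x                                   ∎

  cyc-next-m : (c : Fin n) → cyc (next c) m ≡ c
  cyc-next-m c = trans (sym (cyc-suc c m)) (cyc-n c)

  rank-next-self : (c : Fin n) → rank (next c) c ≡ m
  rank-next-self c = trans (cong (rank (next c)) (sym (cyc-next-m c))) (rank-cyc-< (next c) ≤-refl)

  rank-next : (c x : Fin n) → x ≢ c → rank c x ≡ suc (rank (next c) x)
  rank-next c x x≢c with m≤n⇒m<n∨m≡n (s≤s⁻¹ (rank< (next c) x))
  ... | inj₁ r<m = begin
    rank c x                                   ≡⟨ cong (rank c) (sym (cyc-rank (next c) x)) ⟩
    rank c (cyc (next c) (rank (next c) x))    ≡⟨ cong (rank c) (sym (cyc-suc c _)) ⟩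
    rank c (cyc c (suc (rank (next c) x)))     ≡⟨ rank-cyc-< c (s≤s r<m) ⟩
    suc (rank (next c) x)                      ∎
    where open ≡-Reasoning
  ... | inj₂ r≡m = ⊥-elim (x≢c (rank-injective (next c) (trans r≡m (sym (rank-next-self c)))))

  next-prev : (a : Fin n) → next (prev a) ≡ a
  next-prev a = trans (cyc-+ a m 1) (trans (cong (cyc a) (+-comm m 1)) (cyc-n a))

  prev-next : (a : Fin n) → prev (next a) ≡ a
  prev-next a = trans (cyc-+ a 1 m) (cyc-n a)

  prev-self⇒trivial : (a : Fin n) → prev a ≡ a → (x y : Fin n) → x ≡ y
  prev-self⇒trivial a prev-a≡a x y = toℕ-injective (trans (toℕ≡0 x) (sym (toℕ≡0 y)))
    where
    next-a≡a : next a ≡ a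
    next-a≡a = trans (cong next (sym prev-a≡a)) (next-prev a)
    1%n≡0 : 1 % n ≡ 0
    1%n≡0 = trans (sym (rank-cyc a 1)) (trans (cong (rank a) next-a≡a) (rank-self a))
    m≡0 : ∀ {k} → 1 % suc k ≡ 0 → k ≡ 0
    m≡0 {zero} _ = refl
    m≡0 {suc k} ()
    toℕ≡0 : (w : Fin n) → toℕ w ≡ 0
    toℕ≡0 w = n≤0⇒n≡0 (s≤s⁻¹ (subst (λ k → toℕ w < suc k) (m≡0 1%n≡0) (toℕ<n w)))

  elt-suc : (o : Fin n) (j : ℕ) → elt o (suc j) ≡ next (elt o j)
  elt-suc o j = toℕ-injective (begin
    toℕ (elt o (suc j))        ≡⟨ toℕ-fromℕ< (m%n<n (suc j) n) ⟩
    suc j % n                  ≡⟨ cong (_% n) (+-comm 1 j) ⟩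
    (j + 1) % n                ≡⟨ sym ([m%d+n]%d≡[m+n]%d j 1 n) ⟩
    (j % n + 1) % n            ≡⟨ cong (λ u → (u + 1) % n) (sym (toℕ-fromℕ< (m%n<n j n))) ⟩
    (toℕ (elt o j) + 1) % n    ≡⟨ sym (toℕ-cyc (elt o j) 1) ⟩
    toℕ (next (elt o j))       ∎)
    where open ≡-Reasoning

  elt-toℕ : (a : Fin n) → elt a (toℕ a) ≡ a
  elt-toℕ a = toℕ-injective (trans (toℕ-fromℕ< _) (m<n⇒m%n≡m (toℕ<n a)))

  rank-from-0 : (x : Fin n) → rank Fin.zero x ≡ toℕ x
  rank-from-0 x = trans ([m+n]%n≡m%n (toℕ x) n) (m<n⇒m%n≡m (toℕ<n x))

module _ {m : ℕ} where

  private
    n : ℕ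
    n = suc m

  Btw? : (p q x : Fin n) → Dec (Btw p q x)
  Btw? p q x = (0 <? rank p x) ×-dec (rank p x <? rank p q)

  record Cyclic (a b c : Fin n) : Set where
    constructor cyclic
    field between : Btw a c b
  open Cyclic

  rotate : ∀ a b c → Cyclic a b c → Cyclic b c a
  rotate a b c (cyclic (0<B , B<C)) = cyclic rotated
    where
    B = rank a b
    C = rank a c
    F = rank b c
    G = rank b a
    B+G%n≡0 : (B + G) % n ≡ 0
    B+G%n≡0 = trans (sym (rank-+ a b a)) (rank-self a)
    B+G≡n : B + G ≡ n
    B+G≡n with [m+n]%d-cases B G (rank< a b) (rank< b a)
    ... | inj₁ (eq , _) = ⊥-elim (<⇒≢ (<-≤-trans 0<B (m≤m+n B G)) (trans (sym B+G%n≡0) eq))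
    ... | inj₂ (eq , _) = trans (sym eq) (cong (_+ n) B+G%n≡0)
    rotated : 0 < F × F < G
    rotated with [m+n]%d-cases B F (rank< a b) (rank< b c)
    ... | inj₁ (eq , B+F<n) = n≢0⇒n>0 F≢0 , +-cancelˡ-< B F G (subst (B + F <_) (sym B+G≡n) B+F<n)
      where
      F≢0 : F ≢ 0
      F≢0 F≡0 = <-irrefl (trans (sym (+-identityʳ B)) (trans (cong (B +_) (sym F≡0)) (trans (sym eq) (sym (rank-+ a b c))))) B<C
    ... | inj₂ (eq , _) = ⊥-elim (<-asym B<C C<B)
      where
      C<B : C < B
      C<B = +-cancelʳ-< n C B
        (subst (_< B + n) (sym (trans (cong (_+ n) (rank-+ a b c)) eq)) (+-monoʳ-< B (rank< b c)))

  Cyclic-total : ∀ {a b c} → b ≢ a → c ≢ a → b ≢ c → Cyclic a b c ⊎ Cyclic a c b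
  Cyclic-total {a} {b} {c} b≢a c≢a b≢c with <-cmp (rank a b) (rank a c)
  ... | tri< lt _ _ = inj₁ (cyclic (n≢0⇒n>0 (b≢a ∘ rank≡0⇒≡ a b) , lt))
  ... | tri≈ _ eq _ = ⊥-elim (b≢c (rank-injective a eq))
  ... | tri> _ _ gt = inj₂ (cyclic (n≢0⇒n>0 (c≢a ∘ rank≡0⇒≡ a c) , gt))

  Cyclic-asym : ∀ {a b c} → Cyclic a b c → ¬ Cyclic a c b
  Cyclic-asym (cyclic (_ , b<c)) (cyclic (_ , c<b)) = <-asym b<c c<b

  Cyclic-trans : ∀ {a b c d} → Cyclic a b c → Cyclic a c d → Cyclic a b d
  Cyclic-trans (cyclic (0<b , b<c)) (cyclic (_ , c<d)) = cyclic (0<b , <-trans b<c c<d)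

  sameSide-sym : ∀ {p q r s} → q ≢ p → r ≢ p → s ≢ p → r ≢ q → s ≢ q → s ≢ r →
    (Btw p q r ⇔ Btw p q s) → Btw r s p ⇔ Btw r s q
  sameSide-sym {p} {q} {r} {s} q≢p r≢p s≢p r≢q s≢q s≢r r↔s
    with Cyclic-total r≢p q≢p r≢q | Cyclic-total s≢p q≢p s≢q | Cyclic-total r≢p s≢p (s≢r ∘ sym)
  ... | inj₁ prq | inj₂ pqs | _ = ⊥-elim (Cyclic-asym pqs (cyclic (Equivalence.to r↔s (between prq))))
  ... | inj₂ pqr | inj₁ psq | _ = ⊥-elim (Cyclic-asym pqr (cyclic (Equivalence.from r↔s (between psq))))
  ... | inj₁ prq | inj₁ psq | inj₁ prs = mk⇔
    (λ rps → ⊥-elim (Cyclic-asym (rotate p r s prs) (cyclic rps)))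
    (λ rqs → ⊥-elim (Cyclic-asym (rotate q r s (rotate s q r (Cyclic-trans (rotate p s q psq) (rotate r s p (rotate p r s prs))))) (cyclic rqs)))
  ... | inj₁ prq | inj₁ psq | inj₂ psr = mk⇔
    (λ _ → between (Cyclic-trans (rotate p r q prq) (rotate s r p (rotate p s r psr))))
    (λ _ → between (rotate s r p (rotate p s r psr)))
  ... | inj₂ pqr | inj₂ pqs | inj₁ prs = mk⇔
    (λ rps → ⊥-elim (Cyclic-asym (rotate p r s prs) (cyclic rps)))
    (λ rqs → ⊥-elim (Cyclic-asym (Cyclic-trans (rotate p r s prs) (rotate q r p (rotate p q r pqr))) (cyclic rqs)))
  ... | inj₂ pqr | inj₂ pqs | inj₂ psr = mk⇔
    (λ _ → between (rotate s r q (Cyclic-trans (rotate p s r psr) (rotate q s p (rotate p q s pqs)))))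
    (λ _ → between (rotate s r p (rotate p s r psr)))

  -- For w ≢ z this is the open arc from z to w; for w ≡ z it is everything but z.
  InArc : Fin n → Fin n → Fin n → Set
  InArc z w x = rank (next z) x < rank (next z) w

  arcLength≤n : (z w : Fin n) → rank (next z) w ≤ n
  arcLength≤n z w = <⇒≤ (rank< (next z) w)

  InArc⇒≢start : (z w x : Fin n) → InArc z w x → x ≢ z
  InArc⇒≢start z w x x∈ refl =
    <⇒≱ x∈ (subst (rank (next z) w ≤_) (sym (rank-next-self z)) (s≤s⁻¹ (rank< (next z) w)))

  InArc⇒≢end : (z w x : Fin n) → InArc z w x → x ≢ w
  InArc⇒≢end z w x x∈ refl = <-irrefl refl x∈

  InArc-full : ∀ {z x} → x ≢ z → InArc z z x
  InArc-full {z} {x} x≢z rewrite rank-next-self z with m≤n⇒m<n∨m≡n (s≤s⁻¹ (rank< (next z) x))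
  ... | inj₁ lt = lt
  ... | inj₂ eq = ⊥-elim (x≢z (rank-injective (next z) (trans eq (sym (rank-next-self z)))))

  InArc⇔Btw : ∀ {z w x} → w ≢ z → x ≢ z → InArc z w x ⇔ Btw z w x
  InArc⇔Btw {z} {w} {x} w≢z x≢z = mk⇔
    (λ x∈ → subst (0 <_) (sym x-rank) z<s , subst₂ _<_ (sym x-rank) (sym w-rank) (s≤s x∈))
    (λ (_ , x<w) → s≤s⁻¹ (subst₂ _<_ x-rank w-rank x<w))
    where
    w-rank = rank-next z w w≢z
    x-rank = rank-next z x x≢z

  nonCrossing-sameSideˡ : ∀ {p q r s} → NonCrossing p q r s → InArc p q r ⇔ InArc p q s
  nonCrossing-sameSideˡ {p} {q} {r} {s} (p≢r , p≢s , _ , _ , ¬xor) with q ≟ p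
  ... | yes refl = mk⇔ (λ _ → InArc-full (p≢s ∘ sym)) (λ _ → InArc-full (p≢r ∘ sym))
  ... | no q≢p = ⇔-sym (InArc⇔Btw q≢p (p≢s ∘ sym))
             ⇔-∘ (¬xor⇒⇔ (Btw? p q r) (Btw? p q s) ¬xor
             ⇔-∘ InArc⇔Btw q≢p (p≢r ∘ sym))

  nonCrossing-sameSideʳ : ∀ {p q r s} → NonCrossing p q r s → InArc r s p ⇔ InArc r s q
  nonCrossing-sameSideʳ {p} {q} {r} {s} (p≢r , p≢s , q≢r , q≢s , ¬xor) with s ≟ r | q ≟ p
  ... | yes refl | _        = mk⇔ (λ _ → InArc-full q≢r) (λ _ → InArc-full p≢r)
  ... | no _     | yes refl = mk⇔ (λ p∈ → p∈) (λ p∈ → p∈)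
  ... | no s≢r   | no q≢p   = ⇔-sym (InArc⇔Btw s≢r q≢r)
    ⇔-∘ (sameSide-sym q≢p (p≢r ∘ sym) (p≢s ∘ sym) (q≢r ∘ sym) (q≢s ∘ sym) s≢r
           (¬xor⇒⇔ (Btw? p q r) (Btw? p q s) ¬xor)
    ⇔-∘ InArc⇔Btw s≢r p≢r)

module _ {m : ℕ} where

  private
    n : ℕ
    n = suc m

  count : Subset n → Fin n → ℕ → ℕ
  count S i t = tally (λ d → lookup S (cyc i d)) t

  arcCount : Subset n → Fin n → Fin n → ℕ
  arcCount S z w = count S (next z) (rank (next z) w)

  private
    rank-cyc-in-range : (i : Fin n) {t d : ℕ} → t ≤ n → d < t → rank i (cyc i d) < t
    rank-cyc-in-range i t≤n d<t = subst (_< _) (sym (rank-cyc-< i (<-≤-trans d<t t≤n))) d<t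

  count-cong : (i : Fin n) {t : ℕ} → t ≤ n → (U V : Subset n) →
    (∀ x → rank i x < t → lookup U x ≡ lookup V x) → count U i t ≡ count V i t
  count-cong i t≤n U V U≗V = tally-cong _ (λ d d<t → U≗V (cyc i d) (rank-cyc-in-range i t≤n d<t))

  count-one-more : (i : Fin n) {t : ℕ} → t ≤ n → (U V : Subset n) (e : Fin n) → rank i e < t →
    lookup U e ≡ true → lookup V e ≡ false → (∀ x → rank i x < t → x ≢ e → lookup U x ≡ lookup V x) →
    count U i t ≡ suc (count V i t)
  count-one-more i t≤n U V e e<t Ue Ve U≗V = tally-one-more _ (rank i e) e<t
    (trans (cong (lookup U) (cyc-rank i e)) Ue) (trans (cong (lookup V) (cyc-rank i e)) Ve)
    (λ d d<t d≢e → U≗V (cyc i d) (rank-cyc-in-range i t≤n d<t)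
                      (λ eq → d≢e (trans (sym (rank-cyc-< i (<-≤-trans d<t t≤n))) (cong (rank i) eq))))

  count-suc : (U : Subset n) (i : Fin n) (t : ℕ) → count U i (suc t) ≡ bit (lookup U i) + count U (next i) t
  count-suc U i t = cong₂ _+_ (cong (bit ∘ lookup U) (cyc-0 i)) (tally-cong t (λ d _ → cong (lookup U) (cyc-suc i d)))

  count-snoc : (U : Subset n) (i : Fin n) (t : ℕ) → count U i (suc t) ≡ count U i t + bit (lookup U (cyc i t))
  count-snoc U i t = tally-snoc t _

  count-around : (U : Subset n) (z : Fin n) → count U (next z) n ≡ arcCount U z z + bit (lookup U z)
  count-around U z = begin
    count U (next z) (suc m)                                     ≡⟨ count-snoc U (next z) m ⟩
    count U (next z) m + bit (lookup U (cyc (next z) m))         ≡⟨ cong₂ (λ t x → count U (next z) t + bit (lookup U x))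
                                                                       (sym (rank-next-self z)) (cyc-next-m z) ⟩
    arcCount U z z + bit (lookup U z)                            ∎
    where open ≡-Reasoning

  count-through : (U : Subset n) {z w : Fin n} → w ≢ z →
    count U z (suc (rank z w)) ≡ bit (lookup U z) + (arcCount U z w + bit (lookup U w))
  count-through U {z} {w} w≢z = begin
    count U z (suc (rank z w))                          ≡⟨ cong (count U z ∘ suc) (rank-next z w w≢z) ⟩
    count U z (suc (suc T))                             ≡⟨ count-suc U z (suc T) ⟩
    bit (lookup U z) + count U (next z) (suc T)         ≡⟨ cong (bit (lookup U z) +_) (count-snoc U (next z) T) ⟩
    bit (lookup U z) + (arcCount U z w + bit (lookup U (cyc (next z) T)))
      ≡⟨ cong (λ x → bit (lookup U z) + (arcCount U z w + bit (lookup U x))) (cyc-rank (next z) w) ⟩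
    bit (lookup U z) + (arcCount U z w + bit (lookup U w)) ∎
    where
    open ≡-Reasoning
    T = rank (next z) w

  arcCount-exchange : (S : Subset n) (z w u v : Fin n) → lookup S u ≡ true → (v ≢ u → lookup S v ≡ false) →
    (InArc z w u ⇔ InArc z w v) → arcCount ((S - u) ∪ ⁅ v ⁆) z w ≡ arcCount S z w
  arcCount-exchange S z w u v Su v∉S u↔v with v ≟ u
  ... | yes refl = cong (λ T → arcCount T z w) (exchange-self S Su)
  ... | no v≢u with rank (next z) u <? rank (next z) w
  ...   | yes u∈ = begin
    arcCount ((S - u) ∪ ⁅ v ⁆) z w   ≡⟨ count-one-more (next z) (arcLength≤n z w) ((S - u) ∪ ⁅ v ⁆) (S - u) v (Equivalence.to u↔v u∈)
                                          (exchange-inserted S u v) (trans (remove-other S v≢u) (v∉S v≢u))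
                                          (λ x _ x≢v → exchange-≢inserted S x≢v) ⟩
    suc (arcCount (S - u) z w)       ≡⟨ sym (count-one-more (next z) (arcLength≤n z w) S (S - u) u u∈ Su (remove-removed S u)
                                          (λ x _ x≢u → sym (remove-other S x≢u))) ⟩
    arcCount S z w                   ∎
    where open ≡-Reasoning
  ...   | no u∉ = count-cong (next z) (arcLength≤n z w) ((S - u) ∪ ⁅ v ⁆) S λ x x∈ →
    exchange-other S (λ { refl → u∉ x∈ }) (λ { refl → u∉ (Equivalence.from u↔v x∈) })

  sortedFrom-applyUpTo : (i : Fin n) (S : Subset n) →
    sortedFrom i S ≡ filter (λ a → a ∈? S) (applyUpTo (cyc i) n)
  sortedFrom-applyUpTo i S = cong (filter (λ a → a ∈? S)) (map-applyUpTo (λ x → x) (cyc i) n)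

  length-filter-sortedFrom : (i : Fin n) (S : Subset n) {t : ℕ} → t ≤ n →
    length (filter (λ b → rank i b <? t) (sortedFrom i S)) ≡ count S i t
  length-filter-sortedFrom i S {t} t≤n = begin
    length (filter rank<t? (sortedFrom i S))
      ≡⟨ cong (length ∘ filter rank<t?) (sortedFrom-applyUpTo i S) ⟩
    length (filter rank<t? (filter (λ a → a ∈? S) (applyUpTo (cyc i) n)))
      ≡⟨ length-filter-filter-applyUpTo (λ a → a ∈? S) rank<t? (cyc i) n ⟩
    tally member-before-t n
      ≡⟨ tally-beyond t n member-before-t t≤n (λ d t≤d d<n → none-beyond d t≤d d<n) ⟩
    tally member-before-t t
      ≡⟨ tally-cong t (λ d d<t → all-before d d<t) ⟩
    count S i t ∎
    where
    open ≡-Reasoning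
    rank<t? = λ b → rank i b <? t
    member-before-t : ℕ → Bool
    member-before-t d = does (cyc i d ∈? S) ∧ does (rank i (cyc i d) <? t)
    none-beyond : ∀ d → t ≤ d → d < n → member-before-t d ≡ false
    none-beyond d t≤d d<n
      rewrite dec-false (rank i (cyc i d) <? t) (λ lt → <⇒≱ (subst (_< t) (rank-cyc-< i d<n) lt) t≤d) =
      ∧-zeroʳ _
    all-before : ∀ d → d < t → member-before-t d ≡ lookup S (cyc i d)
    all-before d d<t rewrite dec-true (rank i (cyc i d) <? t) (rank-cyc-in-range i t≤n d<t) =
      trans (∧-identityʳ _) (does-∈? (cyc i d) S)

  length-sortedFrom : (i : Fin n) (S : Subset n) → length (sortedFrom i S) ≡ count S i n
  length-sortedFrom i S =
    trans (cong length (sym (filter-all (λ b → rank i b <? n) (universal (rank< i) (sortedFrom i S)))))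
          (length-filter-sortedFrom i S ≤-refl)

  ≤ᴳ⇒count≥ : (i : Fin n) (A B : Subset n) → A ≤ᴳ[ i ] B → {t : ℕ} → t ≤ n → count B i t ≤ count A i t
  ≤ᴳ⇒count≥ i A B A≤B t≤n = subst₂ _≤_ (length-filter-sortedFrom i B t≤n) (length-filter-sortedFrom i A t≤n)
    (length-filter-mono (λ b → rank i b <? _) (λ a≤b b<t → ≤-<-trans a≤b b<t) A≤B)

  ≤ᴳ⇒count≡ : (i : Fin n) (A B : Subset n) → A ≤ᴳ[ i ] B → count A i n ≡ count B i n
  ≤ᴳ⇒count≡ i A B A≤B = trans (sym (length-sortedFrom i A)) (trans (Pointwise-length A≤B) (length-sortedFrom i B))

-- The forward necklace and the arc-count invariant

module _ {m : ℕ} (π : Permutation′ (suc m)) where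

  private
    n : ℕ
    n = suc m

  ForwardAt : Subset n → Fin n → Set
  ForwardAt X c = ∀ x → lookup X x ≡ does (rank c x ≤? rank c (π ⟨$⟩ˡ x))

  ForwardAt-next : (X : Subset n) (c : Fin n) → ForwardAt X c → ForwardAt ((X - c) ∪ ⁅ π ⟨$⟩ʳ c ⁆) (next c)
  ForwardAt-next X c X-fwd x with x ≟ π ⟨$⟩ʳ c | x ≟ c
  ... | yes refl | _ rewrite inverseˡ π {c} | rank-next-self c =
    trans (exchange-inserted X c _) (sym (dec-true (_ ≤? m) (s≤s⁻¹ (rank< (next c) (π ⟨$⟩ʳ c)))))
  ... | no x≢πc | yes refl rewrite rank-next-self x =
    trans (exchange-removed X x≢πc) (sym (dec-false (m ≤? _) (<⇒≱ π⁻¹x<m)))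
    where
    π⁻¹x≢x : π ⟨$⟩ˡ x ≢ x
    π⁻¹x≢x eq = x≢πc (trans (sym (inverseʳ π)) (cong (π ⟨$⟩ʳ_) eq))
    π⁻¹x<m : rank (next x) (π ⟨$⟩ˡ x) < m
    π⁻¹x<m with m≤n⇒m<n∨m≡n (s≤s⁻¹ (rank< (next x) (π ⟨$⟩ˡ x)))
    ... | inj₁ lt = lt
    ... | inj₂ eq = ⊥-elim (π⁻¹x≢x (rank-injective (next x) (trans eq (sym (rank-next-self x)))))
  ... | no x≢πc | no x≢c = begin
    lookup ((X - c) ∪ ⁅ π ⟨$⟩ʳ c ⁆) x                         ≡⟨ exchange-other X x≢c x≢πc ⟩
    lookup X x                                                ≡⟨ X-fwd x ⟩
    does (rank c x ≤? rank c (π ⟨$⟩ˡ x))                      ≡⟨ cong₂ (λ a b → does (a ≤? b)) (rank-next c x x≢c)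
                                                                   (rank-next c (π ⟨$⟩ˡ x) π⁻¹x≢c) ⟩
    does (suc (rank (next c) x) ≤? suc (rank (next c) (π ⟨$⟩ˡ x)))  ≡⟨ does-⇔ (mk⇔ s≤s⁻¹ s≤s) (_ ≤? _) (rank (next c) x ≤? _) ⟩
    does (rank (next c) x ≤? rank (next c) (π ⟨$⟩ˡ x))        ∎
    where
    open ≡-Reasoning
    π⁻¹x≢c : π ⟨$⟩ˡ x ≢ c
    π⁻¹x≢c eq = x≢πc (trans (sym (inverseʳ π)) (cong (π ⟨$⟩ʳ_) eq))

  fwdℕ-forward : (o : Fin n) (j : ℕ) → ForwardAt (fwdℕ π o j) (elt o j)
  fwdℕ-forward o zero x rewrite rank-from-0 x | rank-from-0 (π ⟨$⟩ˡ x) =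
    lookup∘tabulate (λ a → does (toℕ a ≤? toℕ (π ⟨$⟩ˡ a))) x
  fwdℕ-forward o (suc j) x rewrite elt-suc o j = ForwardAt-next (fwdℕ π o j) (elt o j) (fwdℕ-forward o j) x

  fwdNecklace-forward : (a : Fin n) → ForwardAt (fwdNecklace π a) a
  fwdNecklace-forward a = subst (ForwardAt (fwdNecklace π a)) (elt-toℕ a) (fwdℕ-forward a (toℕ a))

  fwdNecklace-next : (c : Fin n) → fwdNecklace π (next c) ≡ (fwdNecklace π c - c) ∪ ⁅ π ⟨$⟩ʳ c ⁆
  fwdNecklace-next c = subset-ext λ x →
    trans (fwdNecklace-forward (next c) x) (sym (ForwardAt-next (fwdNecklace π c) c (fwdNecklace-forward c) x))

  fwdNecklace-self : (c : Fin n) → lookup (fwdNecklace π c) c ≡ true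
  fwdNecklace-self c rewrite fwdNecklace-forward c c | rank-self c = refl

  fwdNecklace-image : (c : Fin n) → π ⟨$⟩ʳ c ≢ c → lookup (fwdNecklace π c) (π ⟨$⟩ʳ c) ≡ false
  fwdNecklace-image c πc≢c rewrite fwdNecklace-forward c (π ⟨$⟩ʳ c) | inverseˡ π {c} | rank-self c =
    dec-false (rank c (π ⟨$⟩ʳ c) ≤? 0) (πc≢c ∘ rank≡0⇒≡ c _ ∘ n≤0⇒n≡0)

  arcCount-fwdNecklace-next : (z : Fin n) →
    arcCount (fwdNecklace π (next z)) z (π ⟨$⟩ʳ z) ≡ arcCount (fwdNecklace π z) z (π ⟨$⟩ʳ z)
  arcCount-fwdNecklace-next z =
    count-cong (next z) (arcLength≤n z πz) (fwdNecklace π (next z)) (fwdNecklace π z) λ x x∈ →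
      trans (cong (λ S → lookup S x) (fwdNecklace-next z))
            (exchange-other (fwdNecklace π z) (InArc⇒≢start z πz x x∈) (InArc⇒≢end z πz x x∈))
    where
    πz = π ⟨$⟩ʳ z

  -- arcCount≡ is the invariant that noncrossing toggles preserve: along the arc from r to π(r),
  -- J has as many elements as the forward necklace member at r.
  record GoodStep (J J′ : Subset n) (r i : Fin n) : Set where
    field
      exchange   : J′ ≡ (J - r) ∪ ⁅ i ⁆
      removed∈   : lookup J r ≡ true
      inserted≡π : i ≡ π ⟨$⟩ʳ r
      inserted∉  : i ≢ r → lookup J i ≡ false
      arcCount≡  : arcCount J r (π ⟨$⟩ʳ r) ≡ arcCount (fwdNecklace π r) r (π ⟨$⟩ʳ r)
  open GoodStep

  subst-GoodStep : ∀ {J₁ J₂ J₁′ J₂′ r₁ r₂ i₁ i₂} → J₁ ≡ J₂ → J₁′ ≡ J₂′ → r₁ ≡ r₂ → i₁ ≡ i₂ →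
    GoodStep J₁ J₁′ r₁ i₁ → GoodStep J₂ J₂′ r₂ i₂
  subst-GoodStep refl refl refl refl good = good

  GoodNecklace : Necklace n → Set
  GoodNecklace K = ∀ b → GoodStep (I K b) (I K (next b)) (ρ K ⟨$⟩ʳ b) (ι K ⟨$⟩ʳ b)

  fwd-good : GoodNecklace (fwd π)
  fwd-good b = record
    { exchange   = fwdNecklace-next b
    ; removed∈   = fwdNecklace-self b
    ; inserted≡π = refl
    ; inserted∉  = fwdNecklace-image b
    ; arcCount≡  = refl
    }

  module _ {J₀ J₁ J₂ : Subset n} {p q r s : Fin n}
           (first : GoodStep J₀ J₁ p q) (second : GoodStep J₁ J₂ r s)
           (p≢s : p ≢ s) (r≢q : r ≢ q) (nc : NonCrossing p q r s) where

    private
      p≢r : p ≢ r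
      p≢r = proj₁ nc
      q≢r : q ≢ r
      q≢r = proj₁ (proj₂ (proj₂ nc))
      q≢s : q ≢ s
      q≢s = proj₁ (proj₂ (proj₂ (proj₂ nc)))

      J₁≗J₀ : ∀ {x} → x ≢ p → x ≢ q → lookup J₁ x ≡ lookup J₀ x
      J₁≗J₀ {x} x≢p x≢q = trans (cong (λ S → lookup S x) (exchange first)) (exchange-other J₀ x≢p x≢q)

      r∈J₀ : lookup J₀ r ≡ true
      r∈J₀ = trans (sym (J₁≗J₀ (p≢r ∘ sym) r≢q)) (removed∈ second)

      s∉J₀ : s ≢ r → lookup J₀ s ≡ false
      s∉J₀ s≢r = trans (sym (J₁≗J₀ (p≢s ∘ sym) (q≢s ∘ sym))) (inserted∉ second s≢r)

    swap-first : GoodStep J₀ ((J₀ - r) ∪ ⁅ s ⁆) r s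
    swap-first = record
      { exchange   = refl
      ; removed∈   = r∈J₀
      ; inserted≡π = inserted≡π second
      ; inserted∉  = s∉J₀
      ; arcCount≡  = trans (sym J₁-count) (arcCount≡ second)
      }
      where
      J₁-count : arcCount J₁ r (π ⟨$⟩ʳ r) ≡ arcCount J₀ r (π ⟨$⟩ʳ r)
      J₁-count = trans (cong (λ S → arcCount S r (π ⟨$⟩ʳ r)) (exchange first))
        (arcCount-exchange J₀ r (π ⟨$⟩ʳ r) p q (removed∈ first) (inserted∉ first)
          (subst (λ w → InArc r w p ⇔ InArc r w q) (inserted≡π second) (nonCrossing-sameSideʳ nc)))

    swap-second : GoodStep ((J₀ - r) ∪ ⁅ s ⁆) J₂ p q
    swap-second = record
      { exchange   = trans (exchange second)
                       (trans (cong (λ S → (S - r) ∪ ⁅ s ⁆) (exchange first)) (exchange-comm J₀ q≢r p≢s))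
      ; removed∈   = trans (exchange-other J₀ p≢r p≢s) (removed∈ first)
      ; inserted≡π = inserted≡π first
      ; inserted∉  = λ q≢p → trans (exchange-other J₀ q≢r q≢s) (inserted∉ first q≢p)
      ; arcCount≡  = trans (arcCount-exchange J₀ p (π ⟨$⟩ʳ p) r s r∈J₀ s∉J₀
                       (subst (λ w → InArc p w r ⇔ InArc p w s) (inserted≡π first) (nonCrossing-sameSideˡ nc)))
                       (arcCount≡ first)
      }

  toggle-good : ∀ K a → GoodNecklace K → NoncrossingToggle K a → GoodNecklace (toggle K a)
  toggle-good K a good (p≢s , r≢q , nc) b = at b (b ≟ prev a) (b ≟ a)
    where
    K′ = toggle K a
    X = (I K (prev a) - (ρ K ⟨$⟩ʳ a)) ∪ ⁅ ι K ⟨$⟩ʳ a ⁆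
    first = subst-GoodStep refl (cong (I K) (next-prev a)) refl refl (good (prev a))
    prev-a≢a : prev a ≢ a
    prev-a≢a eq = p≢s (prev-self⇒trivial a eq _ _)
    next-a≢a : next a ≢ a
    next-a≢a eq = prev-a≢a (trans (cong prev (sym eq)) (prev-next a))
    at : ∀ b → Dec (b ≡ prev a) → Dec (b ≡ a) →
      GoodStep (I K′ b) (I K′ (next b)) (ρ K′ ⟨$⟩ʳ b) (ι K′ ⟨$⟩ʳ b)
    at _ (yes refl) _ = subst-GoodStep
      (sym (update-≢ (I K) X prev-a≢a))
      (sym (trans (cong (update (I K) a X) (next-prev a)) (update-≡ (I K) a X)))
      (sym (cong (ρ K ⟨$⟩ʳ_) (transpose-matchˡ (prev a) a)))
      (sym (cong (ι K ⟨$⟩ʳ_) (transpose-matchˡ (prev a) a)))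
      (swap-first first (good a) p≢s r≢q nc)
    at _ (no _) (yes refl) = subst-GoodStep
      (sym (update-≡ (I K) a X))
      (sym (update-≢ (I K) X next-a≢a))
      (sym (cong (ρ K ⟨$⟩ʳ_) (transpose-matchʳ (prev a) a (prev-a≢a ∘ sym))))
      (sym (cong (ι K ⟨$⟩ʳ_) (transpose-matchʳ (prev a) a (prev-a≢a ∘ sym))))
      (swap-second first (good a) p≢s r≢q nc)
    at b (no b≢prev-a) (no b≢a) = subst-GoodStep
      (sym (update-≢ (I K) X b≢a))
      (sym (update-≢ (I K) X (λ eq → b≢prev-a (trans (sym (prev-next b)) (cong prev eq)))))
      (sym (cong (ρ K ⟨$⟩ʳ_) (transpose-other (prev a) a b≢prev-a b≢a)))
      (sym (cong (ι K ⟨$⟩ʳ_) (transpose-other (prev a) a b≢prev-a b≢a)))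
      (good b)

  reachable-good : ∀ {K} → Reachable π K → GoodNecklace K
  reachable-good base                           = fwd-good
  reachable-good (step {K} a reach toggleable) = toggle-good K a (reachable-good reach) toggleable

  replaceStart-∉Mπ : ∀ {k J J′ z i} y → GoodStep J J′ z i →
    y <[ z ] (π ⟨$⟩ʳ z) → y ∉ J → ¬ Mπ π k ((J - z) ∪ ⁅ y ⁆)
  replaceStart-∉Mπ {J = J} {z = z} y good y<πz y∉J (_ , gale) =
    1+n≰n (subst (_≤ arcCount J z πz) one-more at-most)
    where
    πz = π ⟨$⟩ʳ z
    S = (J - z) ∪ ⁅ y ⁆
    Jy : lookup J y ≡ false
    Jy = ∉⇒lookup≡false y∉J
    y≢z : y ≢ z
    y≢z y≡z = contradiction (trans (sym (removed∈ good)) (trans (cong (lookup J) (sym y≡z)) Jy)) λ ()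
    πz≢z : πz ≢ z
    πz≢z = <[]⇒≢base z y πz y<πz
    y∈arc : InArc z πz y
    y∈arc = s≤s⁻¹ (subst₂ _<_ (rank-next z y y≢z) (rank-next z πz πz≢z) y<πz)
    one-more : arcCount S z πz ≡ suc (arcCount J z πz)
    one-more = count-one-more (next z) (arcLength≤n z πz) S J y y∈arc (exchange-inserted J z y) Jy
      (λ x x∈ x≢y → exchange-other J (InArc⇒≢start z πz x x∈) x≢y)
    at-most : arcCount S z πz ≤ arcCount J z πz
    at-most = begin
      arcCount S z πz                          ≤⟨ ≤ᴳ⇒count≥ (next z) (fwdNecklace π (next z)) S (gale (next z)) (arcLength≤n z πz) ⟩
      arcCount (fwdNecklace π (next z)) z πz   ≡⟨ arcCount-fwdNecklace-next z ⟩
      arcCount (fwdNecklace π z) z πz          ≡⟨ sym (arcCount≡ good) ⟩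
      arcCount J z πz                          ∎
      where open ≤-Reasoning

  replaceByImage-∉Mπ-fixed : ∀ {k J J′ z i} y → GoodStep J J′ z i →
    π ⟨$⟩ʳ z ≡ z → y ≢ z → y ∈ J → ¬ Mπ π k ((J - y) ∪ ⁅ π ⟨$⟩ʳ z ⁆)
  replaceByImage-∉Mπ-fixed {k} {J} {z = z} y good πz≡z y≢z y∈J M =
    <-irrefl (+-cancelʳ-≡ 1 _ _ balance) (n<1+n (arcCount S z z))
    where
    S = (J - y) ∪ ⁅ z ⁆
    gale : ∀ i → fwdNecklace π i ≤ᴳ[ i ] S
    gale = proj₂ (subst (λ w → Mπ π k ((J - y) ∪ ⁅ w ⁆)) πz≡z M)
    arc-fixed : ∀ U → arcCount U z (π ⟨$⟩ʳ z) ≡ arcCount U z z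
    arc-fixed U = cong (arcCount U z) πz≡z
    one-more : arcCount J z z ≡ suc (arcCount S z z)
    one-more = count-one-more (next z) (arcLength≤n z z) J S y (InArc-full y≢z) ([]=⇒lookup y∈J)
      (exchange-removed J y≢z) (λ x x∈ x≢y → sym (exchange-other J x≢y (InArc⇒≢start z z x x∈)))
    fwd-arc : arcCount (fwdNecklace π (next z)) z z ≡ arcCount J z z
    fwd-arc = begin
      arcCount (fwdNecklace π (next z)) z z              ≡⟨ sym (arc-fixed (fwdNecklace π (next z))) ⟩
      arcCount (fwdNecklace π (next z)) z (π ⟨$⟩ʳ z)     ≡⟨ arcCount-fwdNecklace-next z ⟩
      arcCount (fwdNecklace π z) z (π ⟨$⟩ʳ z)            ≡⟨ sym (arcCount≡ good) ⟩
      arcCount J z (π ⟨$⟩ʳ z)                            ≡⟨ arc-fixed J ⟩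
      arcCount J z z                                     ∎
      where open ≡-Reasoning
    fwd-z : lookup (fwdNecklace π (next z)) z ≡ true
    fwd-z = trans (cong (λ U → lookup U z) (fwdNecklace-next z))
      (subst (λ w → lookup ((fwdNecklace π z - z) ∪ ⁅ w ⁆) z ≡ true) (sym πz≡z) (exchange-inserted (fwdNecklace π z) z z))
    balance : arcCount S z z + 1 ≡ suc (arcCount S z z) + 1
    balance = begin
      arcCount S z z + 1                                                  ≡⟨ cong (λ b → arcCount S z z + bit b) (sym (exchange-inserted J y z)) ⟩
      arcCount S z z + bit (lookup S z)                                   ≡⟨ sym (count-around S z) ⟩
      count S (next z) n                                                  ≡⟨ sym (≤ᴳ⇒count≡ (next z) _ S (gale (next z))) ⟩
      count (fwdNecklace π (next z)) (next z) n                           ≡⟨ count-around (fwdNecklace π (next z)) z ⟩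
      arcCount (fwdNecklace π (next z)) z z + bit (lookup (fwdNecklace π (next z)) z)
                                                                          ≡⟨ cong₂ (λ c b → c + bit b) fwd-arc fwd-z ⟩
      arcCount J z z + 1                                                  ≡⟨ cong (_+ 1) one-more ⟩
      suc (arcCount S z z) + 1                                            ∎
      where open ≡-Reasoning

  replaceByImage-∉Mπ-moved : ∀ {k J J′ z i} y → GoodStep J J′ z i →
    π ⟨$⟩ʳ z ≢ z → y ≢ z → (π ⟨$⟩ʳ z) <[ z ] y → y ∈ J → ¬ Mπ π k ((J - y) ∪ ⁅ π ⟨$⟩ʳ z ⁆)
  replaceByImage-∉Mπ-moved {J = J} {z = z} y good πz≢z y≢z πz<y y∈J (_ , gale) =
    1+n≰n (subst₂ _≤_ (+-comm C 1) (+-identityʳ C) (s≤s⁻¹ two-more))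
    where
    πz = π ⟨$⟩ʳ z
    S = (J - y) ∪ ⁅ πz ⁆
    F = fwdNecklace π z
    C = arcCount J z πz
    shape : ∀ {a a′ b b′ c c′} → a ≡ a′ → b ≡ b′ → c ≡ c′ → bit a + (b + bit c) ≡ bit a′ + (b′ + bit c′)
    shape refl refl refl = refl
    y∉arc : ¬ InArc z πz y
    y∉arc y∈ = <-asym y∈ (s≤s⁻¹ (subst₂ _<_ (rank-next z πz πz≢z) (rank-next z y y≢z) πz<y))
    S-arc : arcCount S z πz ≡ C
    S-arc = count-cong (next z) (arcLength≤n z πz) S J λ x x∈ →
      exchange-other J (λ x≡y → y∉arc (subst (InArc z πz) x≡y x∈)) (InArc⇒≢end z πz x x∈)
    two-more : 1 + (C + 1) ≤ 1 + (C + 0)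
    two-more = begin
      1 + (C + 1)                                                ≡⟨ sym (shape (trans (exchange-other J (y≢z ∘ sym) (πz≢z ∘ sym)) (removed∈ good))
                                                                                S-arc (exchange-inserted J y πz)) ⟩
      bit (lookup S z) + (arcCount S z πz + bit (lookup S πz))   ≡⟨ sym (count-through S πz≢z) ⟩
      count S z (suc (rank z πz))                                ≤⟨ ≤ᴳ⇒count≥ z F S (gale z) (rank< z πz) ⟩
      count F z (suc (rank z πz))                                ≡⟨ count-through F πz≢z ⟩
      bit (lookup F z) + (arcCount F z πz + bit (lookup F πz))   ≡⟨ shape (fwdNecklace-self z) (sym (arcCount≡ good))
                                                                          (fwdNecklace-image z πz≢z) ⟩
      1 + (C + 0)                                                ∎
      where open ≤-Reasoning

  replaceByImage-∉Mπ : ∀ {k J J′ z i} y → GoodStep J J′ z i →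
    (π ⟨$⟩ʳ z) <[ z ] y → y ∈ J → ¬ Mπ π k ((J - y) ∪ ⁅ π ⟨$⟩ʳ z ⁆)
  replaceByImage-∉Mπ {z = z} y good πz<y y∈J with π ⟨$⟩ʳ z ≟ z
  ... | yes πz≡z = replaceByImage-∉Mπ-fixed y good πz≡z (<[]⇒≢base z (π ⟨$⟩ʳ z) y πz<y) y∈J
  ... | no πz≢z  = replaceByImage-∉Mπ-moved y good πz≢z (<[]⇒≢base z (π ⟨$⟩ʳ z) y πz<y) πz<y y∈J

lemma4p7 : ∀ {n k : ℕ} (π : Permutation′ n) → HasType π k →
    (N : Necklace n) → Reachable π N → (y z : Fin n) →
    ((y <[ z ] (π ⟨$⟩ʳ z)) → y ∉ I N (ρ N ⟨$⟩ˡ z) →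
      ¬ Mπ π k ((I N (ρ N ⟨$⟩ˡ z) - z) ∪ ⁅ y ⁆))
    × (((π ⟨$⟩ʳ z) <[ z ] y) → y ∈ I N (ρ N ⟨$⟩ˡ z) →
      ¬ Mπ π k ((I N (ρ N ⟨$⟩ˡ z) - y) ∪ ⁅ π ⟨$⟩ʳ z ⁆))
lemma4p7 {zero}  π _ K _     () z
lemma4p7 {suc m} π _ K reach y  z = replaceStart-∉Mπ π y good , replaceByImage-∉Mπ π y good
  where
  b = ρ K ⟨$⟩ˡ z
  good : GoodStep π (I K b) (I K (next b)) z (ι K ⟨$⟩ʳ b)
  good = subst-GoodStep π refl refl (inverseʳ (ρ K)) refl (reachable-good π reach b)
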